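{- Let $k$ be a nonnegative integer, let $G$ be a connected graph and let $X\subseteq V(G)$. If $S\subseteq X$ is a minimum $k$-power dominating set of $\widehat X$, then $S$ is a $k$-power dominating set of $N_G[X]$ in $G$, i.e. there is $\ell\ge 0$ with $N_G[X]\subseteq \mathscr P^\ell_{G,k}(S)$.
   Context: Graphs are finite, simple and undirected; $N_G[S]=\bigcup_{v\in S}(N_G(v)\cup\{v\})$. $\widehat X$ is the graph obtained from the induced subgraph $G[X]$ by attaching to each vertex $x\in X$ as many new pendent vertices as $x$ has neighbors in $G-X$. For a graph $H=(V,E)$, nonnegative integer $k$ and $S\subseteq V$, define $\mathscr P^0_{H,k}(S)=N_H[S]$ and $\mathscr P^{i+1}_{H,k}(S)=\mathscr P^i_{H,k}(S)\cup\bigcup\{N_H(v): v\in \mathscr P^i_{H,k}(S),\ 1\le |N_H(v)\setminus \mathscr P^i_{H,k}(S)|\le k\}$. $S$ is a $k$-power dominating set of $H$ if $\mathscr P^\ell_{H,k}(S)=V$ for some $\ell$; a minimum one is one of smallest cardinality. -}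

module Defs where

open import Data.Bool using (Bool; true; false; _∧_; _∨_; not; T; if_then_else_)
open import Data.Nat using (ℕ; zero; suc; _≤ᵇ_; _≤_)
open import Data.List using (List; []; _∷_; _++_; map; length; filterᵇ; deduplicate; cartesianProduct)
open import Data.Bool.ListAction using (any)
open import Data.Product using (_×_; _,_; proj₁; proj₂; ∃-syntax)
open import Data.Sum using (_⊎_; inj₁; inj₂)
open import Relation.Nullary.Decidable using (⌊_⌋)
open import Relation.Binary.Definitions using (DecidableEquality)
open import Relation.Binary.PropositionalEquality using (_≡_; refl)
import Data.Sum.Properties as SumP
import Data.Product.Properties as ProdP

-- The vertex set is the set of elements of the list 'verts' (duplicates
-- allowed, they are ignored); elements of the carrier type V that are not
-- in 'verts' are not vertices and are ignored by every notion below.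

record Graph : Set₁ where
  field
    V       : Set
    _≟_     : DecidableEquality V
    verts   : List V
    adj     : V → V → Bool
    adj-sym : ∀ u v → adj u v ≡ adj v u
    adj-irr : ∀ v → adj v v ≡ false

VSet : Graph → Set
VSet G = Graph.V G → Bool

module _ (G : Graph) where
  open Graph G

  vs : List V
  vs = deduplicate _≟_ verts

  inV : V → Bool
  inV v = any (λ u → ⌊ v ≟ u ⌋) verts

  card : VSet G → ℕ
  card A = length (filterᵇ A vs)

  closedNbhd : VSet G → VSet G
  closedNbhd S v = inV v ∧ (S v ∨ any (λ u → S u ∧ adj u v) vs)

  outDeg : VSet G → V → ℕ
  outDeg P u = length (filterᵇ (λ w → adj u w ∧ not (P w)) vs)

  propStep : ℕ → VSet G → VSet G
  propStep k P v =
    P v ∨ (inV v ∧ any (λ u → inV u ∧ P u ∧ adj u v ∧ (1 ≤ᵇ outDeg P u) ∧ (outDeg P u ≤ᵇ k)) vs)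

  𝒫 : ℕ → VSet G → ℕ → VSet G
  𝒫 k S zero    = closedNbhd S
  𝒫 k S (suc i) = propStep k (𝒫 k S i)

  IsKPDS : ℕ → VSet G → Set
  IsKPDS k S = ∃[ ℓ ] (∀ v → T (inV v) → T (𝒫 k S ℓ v))

  IsMinKPDS : ℕ → VSet G → Set
  IsMinKPDS k S = IsKPDS k S × (∀ S′ → IsKPDS k S′ → card S ≤ card S′)

  data Reach (u : V) : V → Set where
    here : T (inV u) → Reach u u
    step : ∀ {w v} → Reach u w → T (inV v) → T (adj w v) → Reach u v

  Connected : Set
  Connected = ∀ u v → T (inV u) → T (inV v) → Reach u v

-- The graph X̂: G[X] with, for every x ∈ X, one pendant vertex for each
-- neighbour of x in G - X.  The pendant vertex for the edge xy
-- (x ∈ X, y ∉ X) is inj₂ (x , y); the vertices of X are inj₁ x.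

module _ (G : Graph) (X : VSet G) where
  open Graph G

  private
    hatAdj : V ⊎ (V × V) → V ⊎ (V × V) → Bool
    hatAdj (inj₁ a) (inj₁ b) = adj a b
    hatAdj (inj₁ a) (inj₂ (x , y)) = ⌊ a ≟ x ⌋
    hatAdj (inj₂ (x , y)) (inj₁ a) = ⌊ a ≟ x ⌋
    hatAdj (inj₂ _) (inj₂ _) = false

    hatSym : ∀ u v → hatAdj u v ≡ hatAdj v u
    hatSym (inj₁ a) (inj₁ b) = adj-sym a b
    hatSym (inj₁ a) (inj₂ _) = refl
    hatSym (inj₂ _) (inj₁ a) = refl
    hatSym (inj₂ _) (inj₂ _) = refl

    hatIrr : ∀ v → hatAdj v v ≡ false
    hatIrr (inj₁ a) = adj-irr a
    hatIrr (inj₂ _) = refl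

    pendant : V × V → Bool
    pendant (x , y) = X x ∧ not (X y) ∧ adj x y

  hat : Graph
  hat = record
    { V       = V ⊎ (V × V)
    ; _≟_     = SumP.≡-dec _≟_ (ProdP.≡-dec _≟_ _≟_)
    ; verts   = map inj₁ (filterᵇ X verts)
              ++ map inj₂ (filterᵇ pendant (cartesianProduct verts verts))
    ; adj     = hatAdj
    ; adj-sym = hatSym
    ; adj-irr = hatIrr
    }

  embed : VSet G → VSet hat
  embed S (inj₁ v) = S v
  embed S (inj₂ _) = false

-- The projection toG : X̂ → G, which is the identity on X and sends the pendant vertex of an
-- edge xy (x ∈ X, y ∉ X) to y, is a graph homomorphism whose image covers N_G[X].  By induction
-- on i it maps 𝒫ⁱ(X̂, S) into 𝒫ⁱ(G, S).  A pendant vertex is only observed once its anchor is,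
-- so every new vertex of X̂ is forced by some a ∈ X; and a has at least as many unobserved
-- neighbours in X̂ as in G, because lifting each G-edge aw to the X̂-edge at a representing it
-- is injective and an observed lift projects to an observed w.  Hence a forces toG h in G too.
module Submission where

open import Defs
open import Data.Bool using (true; false; T; not; _∧_; if_then_else_)
open import Data.Bool.Properties using (T-∧; T-∨; T-≡; T-not-≡)
open import Data.List using (List; []; _∷_; _++_; map; length; filterᵇ)
open import Data.List.Properties using (length-map)
open import Data.List.Membership.Propositional using (_∈_; find; lose)
open import Data.List.Membership.Propositional.Properties
  using (∈-∃++; ∈-++⁺ˡ; ∈-++⁺ʳ; ∈-++⁻; ∈-map⁺; ∈-map⁻; ∈-filter⁺; ∈-filter⁻;
         ∈-cartesianProduct⁺; ∈-cartesianProduct⁻; ∈-deduplicate⁺; ∈-deduplicate⁻)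
open import Data.List.Relation.Binary.Subset.Propositional using (_⊆_)
open import Data.List.Relation.Binary.Permutation.Propositional.Properties using (↭-length; shift)
open import Data.List.Relation.Unary.All as All using ([])
open import Data.List.Relation.Unary.AllPairs using ([]; _∷_)
open import Data.List.Relation.Unary.Any as Any using (here; there)
open import Data.List.Relation.Unary.Any.Properties using (any⁺; any⁻)
open import Data.List.Relation.Unary.Unique.Propositional using (Unique)
import Data.List.Relation.Unary.Unique.Propositional.Properties as Unique
open import Data.List.Relation.Unary.Unique.DecPropositional.Properties using (deduplicate-!)
open import Data.Nat using (ℕ; suc; _≤_; z≤n; s≤s; _≤ᵇ_)
open import Data.Nat.Properties using (≤ᵇ⇒≤; ≤⇒≤ᵇ; ≤-trans)
open import Data.Product using (∃-syntax; _×_; _,_; proj₁; proj₂)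
open import Data.Sum using (_⊎_; inj₁; inj₂)
open import Function using (_∘_)
open import Function.Definitions using (Injective)
open import Function.Bundles using (_⇔_; mk⇔; Equivalence)
open import Relation.Nullary using (¬_; contradiction; yes; no)
open import Relation.Nullary.Decidable using (T?; toWitness; fromWitness)
open import Relation.Binary.PropositionalEquality using (_≡_; refl; sym; trans; cong; subst)

open Equivalence using (to; from)

T-not⇔¬T : ∀ {b} → T (not b) ⇔ (¬ T b)
T-not⇔¬T {true}  = mk⇔ (λ ()) (λ ¬⊤ → ¬⊤ _)
T-not⇔¬T {false} = mk⇔ (λ _ ()) _

Unique∧⊆⇒length≤ : {A : Set} {xs ys : List A} → Unique xs → xs ⊆ ys → length xs ≤ length ys
Unique∧⊆⇒length≤ [] _ = z≤n
Unique∧⊆⇒length≤ {xs = x ∷ xs} (x∉xs ∷ uniq) x∷xs⊆ys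
  with ys₁ , ys₂ , refl ← ∈-∃++ (x∷xs⊆ys (here refl)) =
  subst (suc (length xs) ≤_) (sym (↭-length (shift x ys₁ ys₂)))
        (s≤s (Unique∧⊆⇒length≤ uniq xs⊆ys₁ys₂))
  where
  xs⊆ys₁ys₂ : xs ⊆ ys₁ ++ ys₂
  xs⊆ys₁ys₂ z∈xs with ∈-++⁻ ys₁ (x∷xs⊆ys (there z∈xs))
  ... | inj₁ z∈ys₁         = ∈-++⁺ˡ z∈ys₁
  ... | inj₂ (here refl)   = contradiction refl (All.lookup x∉xs z∈xs)
  ... | inj₂ (there z∈ys₂) = ∈-++⁺ʳ ys₁ z∈ys₂

module _ (G : Graph) where
  open Graph G

  inV⇒∈verts : ∀ {v} → T (inV G v) → v ∈ verts
  inV⇒∈verts = Any.map toWitness ∘ any⁻ _ verts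

  ∈verts⇒inV : ∀ {v} → v ∈ verts → T (inV G v)
  ∈verts⇒inV = any⁺ _ ∘ Any.map fromWitness

  inV⇒∈vs : ∀ {v} → T (inV G v) → v ∈ vs G
  inV⇒∈vs = ∈-deduplicate⁺ _≟_ ∘ inV⇒∈verts

  ∈vs⇒inV : ∀ {v} → v ∈ vs G → T (inV G v)
  ∈vs⇒inV = ∈verts⇒inV ∘ ∈-deduplicate⁻ _≟_ verts

  Dominates : VSet G → V → Set
  Dominates S v = T (S v) ⊎ ∃[ u ] (T (inV G u) × T (S u) × T (adj u v))

  closedNbhd⁻ : ∀ S {v} → T (closedNbhd G S v) → T (inV G v) × Dominates S v
  closedNbhd⁻ S {v} v∈N with to (T-∧ {inV G v}) v∈N
  ... | v-vertex , dom with to (T-∨ {S v}) dom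
  ...   | inj₁ v∈S = v-vertex , inj₁ v∈S
  ...   | inj₂ nbr with find (any⁻ _ (vs G) nbr)
  ...     | u , u∈vs , u∈S∧uv = v-vertex , inj₂ (u , ∈vs⇒inV u∈vs , to (T-∧ {S u}) u∈S∧uv)

  closedNbhd⁺ : ∀ S {v} → T (inV G v) → Dominates S v → T (closedNbhd G S v)
  closedNbhd⁺ S v-vertex (inj₁ v∈S) = from T-∧ (v-vertex , from T-∨ (inj₁ v∈S))
  closedNbhd⁺ S v-vertex (inj₂ (u , u-vertex , u∈S , uv)) =
    from T-∧ (v-vertex , from T-∨ (inj₂ (any⁺ _ (lose (inV⇒∈vs u-vertex) (from T-∧ (u∈S , uv))))))

  record Forces (k : ℕ) (P : VSet G) (u v : V) : Set where
    field
      forcer-vertex   : T (inV G u)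
      forcer-observed : T (P u)
      adjacent        : T (adj u v)
      outDeg≥1        : 1 ≤ outDeg G P u
      outDeg≤k        : outDeg G P u ≤ k

  propStep⁻ : ∀ k P {v} → T (propStep G k P v) → T (P v) ⊎ (T (inV G v) × ∃[ u ] Forces k P u v)
  propStep⁻ k P {v} v∈P′ with to (T-∨ {P v}) v∈P′
  ... | inj₁ v∈P = inj₁ v∈P
  ... | inj₂ forced with to (T-∧ {inV G v}) forced
  ...   | v-vertex , some-forcer with find (any⁻ _ (vs G) some-forcer)
  ...     | u , _ , u-forces with to (T-∧ {inV G u}) u-forces
  ...       | u-vertex , rest₁ with to (T-∧ {P u}) rest₁
  ...         | u∈P , rest₂ with to (T-∧ {adj u v}) rest₂
  ...           | uv , rest₃ with to (T-∧ {1 ≤ᵇ outDeg G P u}) rest₃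
  ...             | pos , bounded =
    inj₂ (v-vertex , u , record
      { forcer-vertex = u-vertex ; forcer-observed = u∈P ; adjacent = uv
      ; outDeg≥1 = ≤ᵇ⇒≤ 1 _ pos ; outDeg≤k = ≤ᵇ⇒≤ _ k bounded })

  propStep⁺ : ∀ k P {u v} → T (inV G v) → Forces k P u v → T (propStep G k P v)
  propStep⁺ k P v-vertex f =
    from T-∨ (inj₂ (from T-∧ (v-vertex , any⁺ _ (lose (inV⇒∈vs forcer-vertex)
      (from T-∧ (forcer-vertex , from T-∧ (forcer-observed , from T-∧ (adjacent ,
        from T-∧ (≤⇒≤ᵇ outDeg≥1 , ≤⇒≤ᵇ outDeg≤k)))))))))
    where open Forces f

  propStep-extensive : ∀ k P {v} → T (P v) → T (propStep G k P v)
  propStep-extensive k P v∈P = from T-∨ (inj₁ v∈P)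

  outDeg-positive : ∀ P {u w} → T (inV G w) → T (adj u w) → ¬ T (P w) → 1 ≤ outDeg G P u
  outDeg-positive P w-vertex uw w∉P = Unique∧⊆⇒length≤ ([] ∷ []) λ where
    (here refl) → ∈-filter⁺ _ (inV⇒∈vs w-vertex) (from T-∧ (uw , from T-not⇔¬T w∉P))

outDeg-mono : (G H : Graph) {P : VSet G} {Q : VSet H} {a : Graph.V G} {b : Graph.V H}
  (f : Graph.V G → Graph.V H) → Injective _≡_ _≡_ f →
  (∀ {w} → T (inV G w) → T (Graph.adj G a w) → ¬ T (P w) →
     T (inV H (f w)) × T (Graph.adj H b (f w)) × ¬ T (Q (f w))) →
  outDeg G P a ≤ outDeg H Q b
outDeg-mono G H {P} {Q} {a} {b} f f-injective f-out =
  subst (_≤ outDeg H Q b) (length-map f outG)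
    (Unique∧⊆⇒length≤ (Unique.map⁺ f-injective outG-unique) image⊆)
  where
  outG : List (Graph.V G)
  outG = filterᵇ (λ w → Graph.adj G a w ∧ not (P w)) (vs G)
  outG-unique : Unique outG
  outG-unique = Unique.filter⁺ _ (deduplicate-! (Graph._≟_ G) (Graph.verts G))
  image⊆ : map f outG ⊆ filterᵇ (λ h → Graph.adj H b h ∧ not (Q h)) (vs H)
  image⊆ fw∈ with ∈-map⁻ f fw∈
  ... | w , w∈outG , refl with ∈-filter⁻ _ w∈outG
  ...   | w∈vs , aw∧w∉P with to (T-∧ {Graph.adj G a w}) aw∧w∉P
  ...     | aw , w∉P with f-out (∈vs⇒inV G w∈vs) aw (to T-not⇔¬T w∉P)
  ...       | fw-vertex , bfw , fw∉Q =
    ∈-filter⁺ _ (inV⇒∈vs H fw-vertex) (from T-∧ (bfw , from T-not⇔¬T fw∉Q))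

record IsHomomorphism (H G : Graph) (f : Graph.V H → Graph.V G) : Set where
  field
    vertex⇒vertex : ∀ {h} → T (inV H h) → T (inV G (f h))
    adj⇒adj       : ∀ {u h} → T (inV H u) → T (inV H h) → T (Graph.adj H u h) →
                    T (Graph.adj G (f u) (f h))

closedNbhd-map : ∀ {H G f} → IsHomomorphism H G f → {A : VSet H} {B : VSet G} →
  (∀ {h} → T (A h) → T (B (f h))) → ∀ {h} → T (closedNbhd H A h) → T (closedNbhd G B (f h))
closedNbhd-map {H} {G} {f} hom {A} {B} A⇒B h∈N with closedNbhd⁻ H A h∈N
... | h-vertex , dom = closedNbhd⁺ G B (vertex⇒vertex h-vertex) (map-dom dom)
  where
  open IsHomomorphism hom
  map-dom : Dominates H A _ → Dominates G B _
  map-dom (inj₁ h∈A) = inj₁ (A⇒B h∈A)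
  map-dom (inj₂ (u , u-vertex , u∈A , uh)) =
    inj₂ (f u , vertex⇒vertex u-vertex , A⇒B u∈A , adj⇒adj u-vertex h-vertex uh)

module _ (G : Graph) (X : VSet G) where
  open Graph G

  private
    X̂ : Graph
    X̂ = hat G X

  toG : Graph.V X̂ → V
  toG (inj₁ v)       = v
  toG (inj₂ (_ , y)) = y

  record PendantEdge (x y : V) : Set where
    field
      anchor∈X      : T (X x)
      leaf∉X        : T (not (X y))
      edge          : T (adj x y)
      anchor-vertex : T (inV G x)
      leaf-vertex   : T (inV G y)

  hat-inj₁⇔ : ∀ {a} → T (inV X̂ (inj₁ a)) ⇔ (T (X a) × T (inV G a))
  hat-inj₁⇔ {a} = mk⇔ to′ from′
    where
    to′ : T (inV X̂ (inj₁ a)) → T (X a) × T (inV G a)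
    to′ a-vertex with ∈-++⁻ (map inj₁ (filterᵇ X verts)) (inV⇒∈verts X̂ a-vertex)
    ... | inj₁ a∈ with ∈-map⁻ inj₁ a∈
    ...   | _ , a∈X , refl with ∈-filter⁻ _ a∈X
    ...     | a∈verts , a∈X′ = a∈X′ , ∈verts⇒inV G a∈verts
    to′ a-vertex | inj₂ a∈ with ∈-map⁻ inj₂ a∈
    ... | _ , _ , ()
    from′ : T (X a) × T (inV G a) → T (inV X̂ (inj₁ a))
    from′ (a∈X , a-vertex) =
      ∈verts⇒inV X̂ (∈-++⁺ˡ (∈-map⁺ inj₁ (∈-filter⁺ _ (inV⇒∈verts G a-vertex) a∈X)))

  hat-inj₂⇔ : ∀ {x y} → T (inV X̂ (inj₂ (x , y))) ⇔ PendantEdge x y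
  hat-inj₂⇔ {x} {y} = mk⇔ to′ from′
    where
    to′ : T (inV X̂ (inj₂ (x , y))) → PendantEdge x y
    to′ xy-vertex with ∈-++⁻ (map inj₁ (filterᵇ X verts)) (inV⇒∈verts X̂ xy-vertex)
    ... | inj₁ xy∈ with ∈-map⁻ inj₁ xy∈
    ...   | _ , _ , ()
    to′ xy-vertex | inj₂ xy∈ with ∈-map⁻ inj₂ xy∈
    ... | _ , xy∈pendants , refl with ∈-filter⁻ _ xy∈pendants
    ...   | xy∈verts² , pendant with ∈-cartesianProduct⁻ verts verts xy∈verts²
    ...     | x∈verts , y∈verts with to (T-∧ {X x}) pendant
    ...       | x∈X , rest with to (T-∧ {not (X y)}) rest
    ...         | y∉X , xy = record
      { anchor∈X = x∈X ; leaf∉X = y∉X ; edge = xy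
      ; anchor-vertex = ∈verts⇒inV G x∈verts ; leaf-vertex = ∈verts⇒inV G y∈verts }
    from′ : PendantEdge x y → T (inV X̂ (inj₂ (x , y)))
    from′ p = ∈verts⇒inV X̂ (∈-++⁺ʳ (map inj₁ (filterᵇ X verts)) (∈-map⁺ inj₂ (∈-filter⁺ _
      (∈-cartesianProduct⁺ (inV⇒∈verts G anchor-vertex) (inV⇒∈verts G leaf-vertex))
      (from T-∧ (anchor∈X , from T-∧ (leaf∉X , edge))))))
      where open PendantEdge p

  pendant-neighbour : ∀ {u x y} → T (Graph.adj X̂ u (inj₂ (x , y))) → u ≡ inj₁ x
  pendant-neighbour {inj₁ a} ax = cong inj₁ (toWitness ax)

  toG-isHomomorphism : IsHomomorphism X̂ G toG
  toG-isHomomorphism = record { vertex⇒vertex = vertex⇒vertex ; adj⇒adj = adj⇒adj }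
    where
    vertex⇒vertex : ∀ {h} → T (inV X̂ h) → T (inV G (toG h))
    vertex⇒vertex {inj₁ _} = proj₂ ∘ to hat-inj₁⇔
    vertex⇒vertex {inj₂ _} = PendantEdge.leaf-vertex ∘ to hat-inj₂⇔
    adj⇒adj : ∀ {u h} → T (inV X̂ u) → T (inV X̂ h) → T (Graph.adj X̂ u h) → T (adj (toG u) (toG h))
    adj⇒adj {inj₁ _} {inj₁ _} _ _ ab = ab
    adj⇒adj {inj₁ a} {inj₂ (x , y)} _ xy-vertex ax with pendant-neighbour {inj₁ a} {x} {y} ax
    ... | refl = PendantEdge.edge (to hat-inj₂⇔ xy-vertex)
    adj⇒adj {inj₂ (x , y)} {inj₁ b} xy-vertex _ bx with pendant-neighbour {inj₁ b} {x} {y} bx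
    ... | refl = subst T (adj-sym x y) (PendantEdge.edge (to hat-inj₂⇔ xy-vertex))

  embed⇒toG : ∀ {S h} → T (embed G X S h) → T (S (toG h))
  embed⇒toG {h = inj₁ _} h∈S = h∈S

  lift : V → V → Graph.V X̂
  lift a w = if X w then inj₁ w else inj₂ (a , w)

  toG∘lift : ∀ a w → toG (lift a w) ≡ w
  toG∘lift a w with X w
  ... | true  = refl
  ... | false = refl

  lift-injective : ∀ a → Injective _≡_ _≡_ (lift a)
  lift-injective a {w} {w′} eq = trans (sym (toG∘lift a w)) (trans (cong toG eq) (toG∘lift a w′))

  lift-neighbour : ∀ {a w} → T (X a) → T (inV G a) → T (inV G w) → T (adj a w) →
    T (inV X̂ (lift a w)) × T (Graph.adj X̂ (inj₁ a) (lift a w))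
  lift-neighbour {a} {w} a∈X a-vertex w-vertex aw with X w in eq
  ... | true  = from hat-inj₁⇔ (from T-≡ eq , w-vertex) , aw
  ... | false = from hat-inj₂⇔ record
    { anchor∈X = a∈X ; leaf∉X = from T-not-≡ eq ; edge = aw
    ; anchor-vertex = a-vertex ; leaf-vertex = w-vertex } , fromWitness refl

  closedNbhd-covered : ∀ {v} → T (closedNbhd G X v) → ∃[ h ] (T (inV X̂ h) × toG h ≡ v)
  closedNbhd-covered {v} v∈N with closedNbhd⁻ G X v∈N
  ... | v-vertex , inj₁ v∈X = inj₁ v , from hat-inj₁⇔ (v∈X , v-vertex) , refl
  ... | v-vertex , inj₂ (u , u-vertex , u∈X , uv) =
    lift u v , proj₁ (lift-neighbour u∈X u-vertex v-vertex uv) , toG∘lift u v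

module _ (k : ℕ) (G : Graph) (X S : VSet G) where
  open Graph G

  private
    X̂ : Graph
    X̂ = hat G X

    P̂ : ℕ → VSet X̂
    P̂ = 𝒫 X̂ k (embed G X S)

    P : ℕ → VSet G
    P = 𝒫 G k S

  pendant∈𝒫⇒anchor∈𝒫 : ∀ i {x y} → T (P̂ i (inj₂ (x , y))) → T (P̂ i (inj₁ x))
  pendant∈𝒫⇒anchor∈𝒫 0 {x} {y} xy∈N with closedNbhd⁻ X̂ (embed G X S) xy∈N
  ... | xy-vertex , inj₂ (u , _ , u∈S , u-xy) with pendant-neighbour G X {u} {x} {y} u-xy
  ...   | refl = closedNbhd⁺ X̂ (embed G X S)
    (from (hat-inj₁⇔ G X) (anchor∈X , anchor-vertex)) (inj₁ u∈S)
    where open PendantEdge (to (hat-inj₂⇔ G X) xy-vertex)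
  pendant∈𝒫⇒anchor∈𝒫 (suc i) {x} {y} xy∈P̂ with propStep⁻ X̂ k (P̂ i) xy∈P̂
  ... | inj₁ xy∈P̂ᵢ = propStep-extensive X̂ k (P̂ i) (pendant∈𝒫⇒anchor∈𝒫 i xy∈P̂ᵢ)
  ... | inj₂ (_ , u , u-forces) with pendant-neighbour G X {u} {x} {y} (Forces.adjacent u-forces)
  ...   | refl = propStep-extensive X̂ k (P̂ i) (Forces.forcer-observed u-forces)

  private
    open IsHomomorphism (toG-isHomomorphism G X)

    toG-preserves-anchor-forcing : ∀ i {a h} → (∀ {h′} → T (P̂ i h′) → T (P i (toG G X h′))) →
      T (inV X̂ h) → Forces X̂ k (P̂ i) (inj₁ a) h → T (P (suc i) (toG G X h))
    toG-preserves-anchor-forcing i {a} {h} projects h-vertex a-forces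
      with to (hat-inj₁⇔ G X) (Forces.forcer-vertex a-forces) | T? (P i (toG G X h))
    ... | _ | yes w∈Pᵢ = propStep-extensive G k (P i) w∈Pᵢ
    ... | a∈X , a-vertex | no w∉Pᵢ = propStep⁺ G k (P i) w-vertex record
      { forcer-vertex   = a-vertex
      ; forcer-observed = projects forcer-observed
      ; adjacent        = aw
      ; outDeg≥1        = outDeg-positive G (P i) w-vertex aw w∉Pᵢ
      ; outDeg≤k        = ≤-trans
          (outDeg-mono G X̂ {Q = P̂ i} {b = inj₁ a} (lift G X a) (lift-injective G X a) lift-out)
          outDeg≤k
      }
      where
      open Forces a-forces
      w-vertex : T (inV G (toG G X h))
      w-vertex = vertex⇒vertex h-vertex
      aw : T (adj a (toG G X h))
      aw = adj⇒adj forcer-vertex h-vertex adjacent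
      lift-out : ∀ {w} → T (inV G w) → T (adj a w) → ¬ T (P i w) →
        T (inV X̂ (lift G X a w)) × T (Graph.adj X̂ (inj₁ a) (lift G X a w))
          × ¬ T (P̂ i (lift G X a w))
      lift-out {w} w-vertex′ aw′ w∉Pᵢ′ =
        let (lw-vertex , a-lw) = lift-neighbour G X a∈X a-vertex w-vertex′ aw′
        in lw-vertex , a-lw , w∉Pᵢ′ ∘ subst (T ∘ P i) (toG∘lift G X a w) ∘ projects

  toG-preserves-𝒫 : ∀ i {h} → T (P̂ i h) → T (P i (toG G X h))
  toG-preserves-𝒫 0 = closedNbhd-map (toG-isHomomorphism G X) (λ {h} → embed⇒toG G X {S} {h})
  toG-preserves-𝒫 (suc i) {h} h∈P̂ with propStep⁻ X̂ k (P̂ i) h∈P̂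
  ... | inj₁ h∈P̂ᵢ = propStep-extensive G k (P i) (toG-preserves-𝒫 i h∈P̂ᵢ)
  ... | inj₂ (h-vertex , inj₁ a , a-forces) =
    toG-preserves-anchor-forcing i (toG-preserves-𝒫 i) h-vertex a-forces
  ... | inj₂ (_ , inj₂ (x , y) , xy-forces)
    with refl ← pendant-neighbour G X {h} {x} {y}
                  (subst T (Graph.adj-sym X̂ _ h) (Forces.adjacent xy-forces)) =
    propStep-extensive G k (P i)
      (toG-preserves-𝒫 i (pendant∈𝒫⇒anchor∈𝒫 i (Forces.forcer-observed xy-forces)))

hat-kPDS⇒closedNbhd⊆𝒫 : ∀ k G X S → IsKPDS (hat G X) k (embed G X S) →
  ∃[ ℓ ] (∀ v → T (closedNbhd G X v) → T (𝒫 G k S ℓ v))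
hat-kPDS⇒closedNbhd⊆𝒫 k G X S (ℓ , all-observed) = ℓ , λ v v∈N →
  let (h , h-vertex , h↦v) = closedNbhd-covered G X v∈N
  in subst (T ∘ 𝒫 G k S ℓ) h↦v (toG-preserves-𝒫 k G X S ℓ (all-observed h h-vertex))

lemma4p3 : (k : ℕ) (G : Graph) (X S : VSet G)
    → Connected G
    → (∀ x → T (X x) → T (inV G x))
    → (∀ v → T (S v) → T (X v))
    → IsMinKPDS (hat G X) k (embed G X S)
    → ∃[ ℓ ] (∀ v → T (closedNbhd G X v) → T (𝒫 G k S ℓ v))
lemma4p3 k G X S _ _ _ (S-dominates , _) = hat-kPDS⇒closedNbhd⊆𝒫 k G X S S-dominates
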